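{- Let $p\ge 1$, $n=2p$, and let $A=[a_{ij}]=\begin{bmatrix}A_1&A_2\\ A_3&A_4\end{bmatrix}$ be an $n\times n$ $(0,1)$-matrix where each block $A_i$ is $p\times p$ and has exactly $k_i$ ones in every row and every column, with $k_i\le p$ ($i=1,2,3,4$) and $k_1+k_4=k_2+k_3$. Let $X'=[x'_{ij}]$ be the $n\times n$ matrix with $x'_{ij}=0$ when $a_{ij}=0$ and, when $a_{ij}=1$, \[ x'_{ij}=\begin{cases} k_4 & (i,j\le p),\\ k_3 & (i\le p,\ j>p),\\ k_2 & (i>p,\ j\le p),\\ k_1 & (i>p,\ j>p),\end{cases} \] and assume $x'_{ij}>0$ precisely when $a_{ij}=1$. Define $X=\frac{1}{k_1k_4+k_2k_3}X'$. Then $X$ is a doubly stochastic matrix whose zero entries are exactly the zero entries of $A$, and all diagonals of $X$ avoiding the zeros of $A$ have the same diagonal sum (that is, $X$ is an RCDS doubly stochastic matrix with pattern $A$).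
   Context: A square nonnegative matrix is doubly stochastic if all row and column sums equal $1$. For a permutation $\sigma$ of $\{1,\ldots,n\}$, the diagonal corresponding to $\sigma$ is the set of positions $(i,\sigma(i))$, with diagonal sum $\sum_i x_{i,\sigma(i)}$; it avoids the zeros of $A$ if $a_{i,\sigma(i)}=1$ for all $i$. -}

module Defs where

open import Data.Nat as ℕ using (ℕ; zero; suc; _+_; _*_; _≡ᵇ_; NonZero)
open import Data.Integer using (+_)
open import Data.Rational as ℚ using (ℚ; 0ℚ; 1ℚ; _/_) renaming (_+_ to _+ℚ_; _≤_ to _≤ℚ_)
open import Data.Fin using (Fin; zero; suc; splitAt; _↑ˡ_; _↑ʳ_)
open import Data.Fin.Permutation using (Permutation′; _⟨$⟩ʳ_)
open import Data.Sum using (_⊎_; inj₁; inj₂)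
open import Data.Bool using (if_then_else_)
open import Relation.Binary.PropositionalEquality using (_≡_)

Mat : Set → ℕ → Set
Mat R n = Fin n → Fin n → R

sumℕ : ∀ {n} → (Fin n → ℕ) → ℕ
sumℕ {zero}  f = 0
sumℕ {suc n} f = f zero + sumℕ (λ i → f (suc i))

sumℚ : ∀ {n} → (Fin n → ℚ) → ℚ
sumℚ {zero}  f = 0ℚ
sumℚ {suc n} f = f zero +ℚ sumℚ (λ i → f (suc i))

IsZeroOne : ∀ {n} → Mat ℕ n → Set
IsZeroOne A = ∀ i j → A i j ≡ 0 ⊎ A i j ≡ 1

onesInRow : ∀ {m} → Mat ℕ m → Fin m → ℕ
onesInRow B i = sumℕ (λ j → if B i j ≡ᵇ 1 then 1 else 0)

onesInCol : ∀ {m} → Mat ℕ m → Fin m → ℕ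
onesInCol B j = sumℕ (λ i → if B i j ≡ᵇ 1 then 1 else 0)

Regular : ∀ {m} → Mat ℕ m → ℕ → Set
Regular B k = (∀ i → onesInRow B i ≡ k) × (∀ j → onesInCol B j ≡ k)
  where open import Data.Product using (_×_)

block₁ block₂ block₃ block₄ : ∀ p → Mat ℕ (p + p) → Mat ℕ p
block₁ p A i j = A (i ↑ˡ p) (j ↑ˡ p)
block₂ p A i j = A (i ↑ˡ p) (p ↑ʳ j)
block₃ p A i j = A (p ↑ʳ i) (j ↑ˡ p)
block₄ p A i j = A (p ↑ʳ i) (p ↑ʳ j)

blockVal : ∀ p (k₁ k₂ k₃ k₄ : ℕ) → Fin (p + p) → Fin (p + p) → ℕ
blockVal p k₁ k₂ k₃ k₄ i j with splitAt p i | splitAt p j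
... | inj₁ _ | inj₁ _ = k₄
... | inj₁ _ | inj₂ _ = k₃
... | inj₂ _ | inj₁ _ = k₂
... | inj₂ _ | inj₂ _ = k₁

X′ : ∀ p (k₁ k₂ k₃ k₄ : ℕ) → Mat ℕ (p + p) → Mat ℕ (p + p)
X′ p k₁ k₂ k₃ k₄ A i j = if A i j ≡ᵇ 1 then blockVal p k₁ k₂ k₃ k₄ i j else 0

X : ∀ p (k₁ k₂ k₃ k₄ : ℕ) → .{{_ : NonZero (k₁ * k₄ + k₂ * k₃)}} →
    Mat ℕ (p + p) → Mat ℚ (p + p)
X p k₁ k₂ k₃ k₄ A i j = (+ X′ p k₁ k₂ k₃ k₄ A i j) / (k₁ * k₄ + k₂ * k₃)

DoublyStochastic : ∀ {n} → Mat ℚ n → Set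
DoublyStochastic M =
  (∀ i j → 0ℚ ≤ℚ M i j) × (∀ i → sumℚ (λ j → M i j) ≡ 1ℚ) × (∀ j → sumℚ (λ i → M i j) ≡ 1ℚ)
  where open import Data.Product using (_×_)

diagSum : ∀ {n} → Mat ℚ n → Permutation′ n → ℚ
diagSum M σ = sumℚ (λ i → M i (σ ⟨$⟩ʳ i))

AvoidsZeros : ∀ {n} → Mat ℕ n → Permutation′ n → Set
AvoidsZeros A σ = ∀ i → A i (σ ⟨$⟩ʳ i) ≡ 1

-- Within each block X′ is a constant times the block's (0,1)-pattern, so a row or column
-- of X′ meets two regular blocks and sums to k₁k₄ + k₂k₃ (along a top row: k₁·k₄ + k₂·k₃).
-- For the diagonals, k₁ + k₄ = k₂ + k₃ says exactly that the block constants split as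
-- r i + c j, and a diagonal avoiding the zeros of A picks up every r i and every c j once.
module Submission where

open import Defs
open import Data.Nat using (ℕ; _+_; _*_; _≤_; _<_; NonZero)
open import Data.Rational using (ℚ; 0ℚ)
open import Data.Fin.Permutation using (Permutation′)
open import Data.Product using (_×_)
open import Function.Bundles using (_⇔_)
open import Relation.Binary.PropositionalEquality using (_≡_)

open import Data.Nat using (zero; suc; _≡ᵇ_)
import Data.Nat.Properties as ℕ
open import Data.Integer as ℤ using (ℤ; +_)
open import Data.Integer.Solver using (module +-*-Solver)
open import Data.Rational as ℚ using (1ℚ; _/_; toℚᵘ)
import Data.Rational.Properties as ℚ
import Data.Rational.Unnormalised as ℚᵘ
import Data.Rational.Unnormalised.Properties as ℚᵘ
open import Data.Fin using (Fin; zero; suc; splitAt; join; _↑ˡ_; _↑ʳ_)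
open import Data.Fin.Properties using (splitAt-↑ˡ; splitAt-↑ʳ; join-splitAt)
open import Data.Fin.Permutation using (_⟨$⟩ʳ_)
open import Data.Sum using (inj₁; inj₂; [_,_])
open import Data.Bool using (Bool; true; false; if_then_else_)
open import Data.Product using (_,_; proj₁; proj₂)
open import Function using (_∘_; const)
open import Function.Bundles using (mk⇔; Equivalence)
open import Relation.Binary.PropositionalEquality
  using (refl; sym; trans; cong; cong₂; subst; _≗_; module ≡-Reasoning)
import Algebra.Properties.Semiring.Sum as SemiringSum

module ∑ = SemiringSum ℕ.+-*-semiring

sumℕ≡sum : ∀ {n} (f : Fin n → ℕ) → sumℕ f ≡ ∑.sum f
sumℕ≡sum {zero}  f = refl
sumℕ≡sum {suc n} f = cong (λ s → f zero + s) (sumℕ≡sum (f ∘ suc))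

sumℕ-cong : ∀ {n} {f g : Fin n → ℕ} → f ≗ g → sumℕ f ≡ sumℕ g
sumℕ-cong {f = f} {g} f≗g
  rewrite sumℕ≡sum f | sumℕ≡sum g = ∑.sum-cong-≗ f≗g

sumℕ-distrib-+ : ∀ {n} (f g : Fin n → ℕ) → sumℕ (λ i → f i + g i) ≡ sumℕ f + sumℕ g
sumℕ-distrib-+ f g
  rewrite sumℕ≡sum (λ i → f i + g i) | sumℕ≡sum f | sumℕ≡sum g = ∑.∑-distrib-+ f g

sumℕ-*ʳ : ∀ {n} (f : Fin n → ℕ) c → sumℕ (λ i → f i * c) ≡ sumℕ f * c
sumℕ-*ʳ f c
  rewrite sumℕ≡sum (λ i → f i * c) | sumℕ≡sum f = sym (∑.*-distribʳ-sum c f)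

sumℕ-permute : ∀ {n} (f : Fin n → ℕ) (π : Permutation′ n) →
               sumℕ f ≡ sumℕ (λ i → f (π ⟨$⟩ʳ i))
sumℕ-permute f π
  rewrite sumℕ≡sum f | sumℕ≡sum (λ i → f (π ⟨$⟩ʳ i)) = ∑.sum-permute f π

sumℕ-↑ : ∀ m {n} (f : Fin (m + n) → ℕ) →
         sumℕ f ≡ sumℕ (λ i → f (i ↑ˡ n)) + sumℕ (λ j → f (m ↑ʳ j))
sumℕ-↑ zero    f = refl
sumℕ-↑ (suc m) f =
  trans (cong (λ s → f zero + s) (sumℕ-↑ m (f ∘ suc))) (sym (ℕ.+-assoc (f zero) _ _))

sumℕ-if : ∀ {n} (b : Fin n → Bool) c →
          sumℕ (λ i → if b i then c else 0) ≡ sumℕ (λ i → if b i then 1 else 0) * c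
sumℕ-if b c = trans (sumℕ-cong (λ i → if-scale (b i))) (sumℕ-*ʳ (λ i → if b i then 1 else 0) c)
  where
  if-scale : ∀ β → (if β then c else 0) ≡ (if β then 1 else 0) * c
  if-scale true  = sym (ℕ.*-identityˡ c)
  if-scale false = refl

module _ {m} (B : Mat ℕ m) {k : ℕ} (regular : Regular B k) (c : ℕ) where

  weighted-rowSum : ∀ i {f : Fin m → ℕ} → (∀ j → f j ≡ (if B i j ≡ᵇ 1 then c else 0)) →
                    sumℕ f ≡ k * c
  weighted-rowSum i {f} f≗ = begin
    sumℕ f                                          ≡⟨ sumℕ-cong f≗ ⟩
    sumℕ (λ j → if B i j ≡ᵇ 1 then c else 0)        ≡⟨ sumℕ-if (λ j → B i j ≡ᵇ 1) c ⟩
    onesInRow B i * c                               ≡⟨ cong (_* c) (proj₁ regular i) ⟩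
    k * c                                           ∎
    where open ≡-Reasoning

  weighted-colSum : ∀ j {f : Fin m → ℕ} → (∀ i → f i ≡ (if B i j ≡ᵇ 1 then c else 0)) →
                    sumℕ f ≡ k * c
  weighted-colSum j {f} f≗ = begin
    sumℕ f                                          ≡⟨ sumℕ-cong f≗ ⟩
    sumℕ (λ i → if B i j ≡ᵇ 1 then c else 0)        ≡⟨ sumℕ-if (λ i → B i j ≡ᵇ 1) c ⟩
    onesInCol B j * c                               ≡⟨ cong (_* c) (proj₂ regular j) ⟩
    k * c                                           ∎
    where open ≡-Reasoning

diagSumℕ : ∀ {n} → Mat ℕ n → Permutation′ n → ℕ
diagSumℕ M σ = sumℕ (λ i → M i (σ ⟨$⟩ʳ i))

-- M i j = r i + t j − s j, written without subtraction.
module _ {n} {M : Mat ℕ n} {r s t : Fin n → ℕ}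
         (potential : ∀ i j → M i j + s j ≡ r i + t j) where

  diagSumℕ-+-sum : ∀ σ → diagSumℕ M σ + sumℕ s ≡ sumℕ r + sumℕ t
  diagSumℕ-+-sum σ = begin
    diagSumℕ M σ + sumℕ s                        ≡⟨ cong (λ z → diagSumℕ M σ + z) (sumℕ-permute s σ) ⟩
    diagSumℕ M σ + sumℕ (s ∘ σ′)                 ≡⟨ sumℕ-distrib-+ (λ i → M i (σ′ i)) (s ∘ σ′) ⟨
    sumℕ (λ i → M i (σ′ i) + s (σ′ i))           ≡⟨ sumℕ-cong (λ i → potential i (σ′ i)) ⟩
    sumℕ (λ i → r i + t (σ′ i))                  ≡⟨ sumℕ-distrib-+ r (t ∘ σ′) ⟩
    sumℕ r + sumℕ (t ∘ σ′)                       ≡⟨ cong (λ z → sumℕ r + z) (sumℕ-permute t σ) ⟨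
    sumℕ r + sumℕ t                              ∎
    where open ≡-Reasoning
          σ′ = σ ⟨$⟩ʳ_

  diagSumℕ-invariant : ∀ σ τ → diagSumℕ M σ ≡ diagSumℕ M τ
  diagSumℕ-invariant σ τ =
    ℕ.+-cancelʳ-≡ (sumℕ s) _ _ (trans (diagSumℕ-+-sum σ) (sym (diagSumℕ-+-sum τ)))

/-distrib-+ : ∀ (m n : ℤ) d .{{_ : NonZero d}} → (m ℤ.+ n) / d ≡ m / d ℚ.+ n / d
/-distrib-+ m n (suc d-1) = ℚ.toℚᵘ-injective (begin
  toℚᵘ ((m ℤ.+ n) / d)                          ≈⟨ ℚ.toℚᵘ-fromℚᵘ (ℚᵘ.mkℚᵘ (m ℤ.+ n) d-1) ⟩
  ℚᵘ.mkℚᵘ (m ℤ.+ n) d-1                         ≈⟨ ℚᵘ.*≡* (numerators m n (+ d)) ⟩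
  ℚᵘ.mkℚᵘ m d-1 ℚᵘ.+ ℚᵘ.mkℚᵘ n d-1              ≈⟨ ℚᵘ.+-cong (ℚ.toℚᵘ-fromℚᵘ (ℚᵘ.mkℚᵘ m d-1))
                                                             (ℚ.toℚᵘ-fromℚᵘ (ℚᵘ.mkℚᵘ n d-1)) ⟨
  toℚᵘ (m / d) ℚᵘ.+ toℚᵘ (n / d)                ≈⟨ ℚ.toℚᵘ-homo-+ (m / d) (n / d) ⟨
  toℚᵘ (m / d ℚ.+ n / d)                        ∎)
  where
  open ℚᵘ.≃-Reasoning
  d = suc d-1
  numerators : ∀ m n d → (m ℤ.+ n) ℤ.* (d ℤ.* d) ≡ (m ℤ.* d ℤ.+ n ℤ.* d) ℤ.* d
  numerators = solve 3 (λ m n d → (m :+ n) :* (d :* d) := (m :* d :+ n :* d) :* d) refl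
    where open +-*-Solver

sumℚ-/ : ∀ {n} (f : Fin n → ℕ) d .{{_ : NonZero d}} →
         sumℚ (λ i → + f i / d) ≡ + sumℕ f / d
sumℚ-/ {zero}  f d = sym (ℚ.0/n≡0 d)
sumℚ-/ {suc n} f d = begin
  + f zero / d ℚ.+ sumℚ (λ i → + f (suc i) / d)  ≡⟨ cong (+ f zero / d ℚ.+_) (sumℚ-/ (f ∘ suc) d) ⟩
  + f zero / d ℚ.+ + sumℕ (f ∘ suc) / d          ≡⟨ /-distrib-+ (+ f zero) (+ sumℕ (f ∘ suc)) d ⟨
  + sumℕ f / d                                   ∎
  where open ≡-Reasoning

n/n≡1 : ∀ n .{{_ : NonZero n}} → + n / n ≡ 1ℚ
n/n≡1 (suc n-1) = ℚ.fromℚᵘ-cong {ℚᵘ.mkℚᵘ (+ suc n-1) n-1} {ℚᵘ.1ℚᵘ}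
                    (ℚᵘ.*≡* (cong +_ (ℕ.*-comm (suc n-1) 1)))

0≤n/d : ∀ n d .{{_ : NonZero d}} → 0ℚ ℚ.≤ + n / d
0≤n/d n d = ℚ.nonNegative⁻¹ _ {{ℚ.normalize-nonNeg n d}}

n/d≡0⇒n≡0 : ∀ n d .{{_ : NonZero d}} → + n / d ≡ 0ℚ → n ≡ 0
n/d≡0⇒n≡0 zero    d _ = refl
n/d≡0⇒n≡0 (suc n) d n/d≡0 with subst ℚ.Positive n/d≡0 (ℚ.normalize-pos (suc n) d)
... | ()

sumℚ-/-≡1 : ∀ {n} (f : Fin n → ℕ) d .{{_ : NonZero d}} → sumℕ f ≡ d →
            sumℚ (λ i → + f i / d) ≡ 1ℚ
sumℚ-/-≡1 f d Σf≡d = trans (sumℚ-/ f d) (trans (cong (λ s → + s / d) Σf≡d) (n/n≡1 d))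

↑-elim : ∀ m {n} (P : Fin (m + n) → Set) →
         (∀ i → P (i ↑ˡ n)) → (∀ j → P (m ↑ʳ j)) → ∀ i → P i
↑-elim m {n} P left right i =
  subst P (join-splitAt m n i) ([_,_] {C = P ∘ join m n} left right (splitAt m i))

module Blocks (p k₁ k₂ k₃ k₄ : ℕ) (A : Mat ℕ (p + p)) where

  x′ : Mat ℕ (p + p)
  x′ = X′ p k₁ k₂ k₃ k₄ A

  X′-block₁ : ∀ i j → x′ (i ↑ˡ p) (j ↑ˡ p) ≡ (if block₁ p A i j ≡ᵇ 1 then k₄ else 0)
  X′-block₁ i j rewrite splitAt-↑ˡ p i p | splitAt-↑ˡ p j p = refl

  X′-block₂ : ∀ i j → x′ (i ↑ˡ p) (p ↑ʳ j) ≡ (if block₂ p A i j ≡ᵇ 1 then k₃ else 0)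
  X′-block₂ i j rewrite splitAt-↑ˡ p i p | splitAt-↑ʳ p p j = refl

  X′-block₃ : ∀ i j → x′ (p ↑ʳ i) (j ↑ˡ p) ≡ (if block₃ p A i j ≡ᵇ 1 then k₂ else 0)
  X′-block₃ i j rewrite splitAt-↑ʳ p p i | splitAt-↑ˡ p j p = refl

  X′-block₄ : ∀ i j → x′ (p ↑ʳ i) (p ↑ʳ j) ≡ (if block₄ p A i j ≡ᵇ 1 then k₁ else 0)
  X′-block₄ i j rewrite splitAt-↑ʳ p p i | splitAt-↑ʳ p p j = refl

  module _ (R₁ : Regular (block₁ p A) k₁) (R₂ : Regular (block₂ p A) k₂)
           (R₃ : Regular (block₃ p A) k₃) (R₄ : Regular (block₄ p A) k₄) where

    rowSum-X′ : ∀ i → sumℕ (x′ i) ≡ k₁ * k₄ + k₂ * k₃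
    rowSum-X′ = ↑-elim p (λ i → sumℕ (x′ i) ≡ k₁ * k₄ + k₂ * k₃) top bottom
      where
      open ≡-Reasoning
      top : ∀ i → sumℕ (x′ (i ↑ˡ p)) ≡ k₁ * k₄ + k₂ * k₃
      top i = begin
        sumℕ (x′ (i ↑ˡ p))
          ≡⟨ sumℕ-↑ p (x′ (i ↑ˡ p)) ⟩
        sumℕ (λ j → x′ (i ↑ˡ p) (j ↑ˡ p)) + sumℕ (λ j → x′ (i ↑ˡ p) (p ↑ʳ j))
          ≡⟨ cong₂ _+_ (weighted-rowSum (block₁ p A) R₁ k₄ i (X′-block₁ i))
                       (weighted-rowSum (block₂ p A) R₂ k₃ i (X′-block₂ i)) ⟩
        k₁ * k₄ + k₂ * k₃
          ∎
      bottom : ∀ i → sumℕ (x′ (p ↑ʳ i)) ≡ k₁ * k₄ + k₂ * k₃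
      bottom i = begin
        sumℕ (x′ (p ↑ʳ i))
          ≡⟨ sumℕ-↑ p (x′ (p ↑ʳ i)) ⟩
        sumℕ (λ j → x′ (p ↑ʳ i) (j ↑ˡ p)) + sumℕ (λ j → x′ (p ↑ʳ i) (p ↑ʳ j))
          ≡⟨ cong₂ _+_ (weighted-rowSum (block₃ p A) R₃ k₂ i (X′-block₃ i))
                       (weighted-rowSum (block₄ p A) R₄ k₁ i (X′-block₄ i)) ⟩
        k₃ * k₂ + k₄ * k₁
          ≡⟨ ℕ.+-comm (k₃ * k₂) (k₄ * k₁) ⟩
        k₄ * k₁ + k₃ * k₂
          ≡⟨ cong₂ _+_ (ℕ.*-comm k₄ k₁) (ℕ.*-comm k₃ k₂) ⟩
        k₁ * k₄ + k₂ * k₃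
          ∎

    colSum-X′ : ∀ j → sumℕ (λ i → x′ i j) ≡ k₁ * k₄ + k₂ * k₃
    colSum-X′ = ↑-elim p (λ j → sumℕ (λ i → x′ i j) ≡ k₁ * k₄ + k₂ * k₃) left right
      where
      open ≡-Reasoning
      left : ∀ j → sumℕ (λ i → x′ i (j ↑ˡ p)) ≡ k₁ * k₄ + k₂ * k₃
      left j = begin
        sumℕ (λ i → x′ i (j ↑ˡ p))
          ≡⟨ sumℕ-↑ p (λ i → x′ i (j ↑ˡ p)) ⟩
        sumℕ (λ i → x′ (i ↑ˡ p) (j ↑ˡ p)) + sumℕ (λ i → x′ (p ↑ʳ i) (j ↑ˡ p))
          ≡⟨ cong₂ _+_ (weighted-colSum (block₁ p A) R₁ k₄ j (λ i → X′-block₁ i j))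
                       (weighted-colSum (block₃ p A) R₃ k₂ j (λ i → X′-block₃ i j)) ⟩
        k₁ * k₄ + k₃ * k₂
          ≡⟨ cong (λ z → k₁ * k₄ + z) (ℕ.*-comm k₃ k₂) ⟩
        k₁ * k₄ + k₂ * k₃
          ∎
      right : ∀ j → sumℕ (λ i → x′ i (p ↑ʳ j)) ≡ k₁ * k₄ + k₂ * k₃
      right j = begin
        sumℕ (λ i → x′ i (p ↑ʳ j))
          ≡⟨ sumℕ-↑ p (λ i → x′ i (p ↑ʳ j)) ⟩
        sumℕ (λ i → x′ (i ↑ˡ p) (p ↑ʳ j)) + sumℕ (λ i → x′ (p ↑ʳ i) (p ↑ʳ j))
          ≡⟨ cong₂ _+_ (weighted-colSum (block₂ p A) R₂ k₃ j (λ i → X′-block₂ i j))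
                       (weighted-colSum (block₄ p A) R₄ k₁ j (λ i → X′-block₄ i j)) ⟩
        k₂ * k₃ + k₄ * k₁
          ≡⟨ ℕ.+-comm (k₂ * k₃) (k₄ * k₁) ⟩
        k₄ * k₁ + k₂ * k₃
          ≡⟨ cong (_+ k₂ * k₃) (ℕ.*-comm k₄ k₁) ⟩
        k₁ * k₄ + k₂ * k₃
          ∎

  X′-support : ∀ {i j} → A i j ≡ 1 → x′ i j ≡ blockVal p k₁ k₂ k₃ k₄ i j
  X′-support Aij≡1 rewrite Aij≡1 = refl

  X′-vanishes : ∀ {i j} → A i j ≡ 0 → x′ i j ≡ 0
  X′-vanishes Aij≡0 rewrite Aij≡0 = refl

  X′≡0⇔A≡0 : IsZeroOne A → (∀ i j → (0 < x′ i j) ⇔ (A i j ≡ 1)) →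
             ∀ i j → (x′ i j ≡ 0) ⇔ (A i j ≡ 0)
  X′≡0⇔A≡0 zeroOne support i j = mk⇔ to X′-vanishes
    where
    to : x′ i j ≡ 0 → A i j ≡ 0
    to x′ij≡0 with zeroOne i j
    ... | inj₁ Aij≡0 = Aij≡0
    ... | inj₂ Aij≡1 with subst (0 <_) x′ij≡0 (Equivalence.from (support i j) Aij≡1)
    ...   | ()

  halves : ℕ → ℕ → Fin (p + p) → ℕ
  halves a b i = [ const a , const b ] (splitAt p i)

  -- blockVal i j = r i + (t j − s j) with r = (k₄ | k₂) and t − s = (0 | k₃ − k₄).
  blockVal-potential : k₁ + k₄ ≡ k₂ + k₃ → ∀ i j →
    blockVal p k₁ k₂ k₃ k₄ i j + halves 0 k₄ j ≡ halves k₄ k₂ i + halves 0 k₃ j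
  blockVal-potential k₁+k₄≡k₂+k₃ i j with splitAt p i | splitAt p j
  ... | inj₁ _ | inj₁ _ = refl
  ... | inj₁ _ | inj₂ _ = ℕ.+-comm k₃ k₄
  ... | inj₂ _ | inj₁ _ = refl
  ... | inj₂ _ | inj₂ _ = k₁+k₄≡k₂+k₃

  diagSumℕ-X′-invariant : k₁ + k₄ ≡ k₂ + k₃ → ∀ σ τ → AvoidsZeros A σ → AvoidsZeros A τ →
                          diagSumℕ x′ σ ≡ diagSumℕ x′ τ
  diagSumℕ-X′-invariant k₁+k₄≡k₂+k₃ σ τ σ-avoids τ-avoids = begin
    diagSumℕ x′ σ                         ≡⟨ sumℕ-cong (λ i → X′-support (σ-avoids i)) ⟩
    diagSumℕ (blockVal p k₁ k₂ k₃ k₄) σ   ≡⟨ diagSumℕ-invariant {r = halves k₄ k₂} {halves 0 k₄} {halves 0 k₃}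
                                               (blockVal-potential k₁+k₄≡k₂+k₃) σ τ ⟩
    diagSumℕ (blockVal p k₁ k₂ k₃ k₄) τ   ≡⟨ sumℕ-cong (λ i → X′-support (τ-avoids i)) ⟨
    diagSumℕ x′ τ                         ∎
    where open ≡-Reasoning

theorem5p4 : (p : ℕ) → 1 ≤ p → (A : Mat ℕ (p + p)) → IsZeroOne A →
    (k₁ k₂ k₃ k₄ : ℕ) →
    Regular (block₁ p A) k₁ → Regular (block₂ p A) k₂ →
    Regular (block₃ p A) k₃ → Regular (block₄ p A) k₄ →
    k₁ ≤ p → k₂ ≤ p → k₃ ≤ p → k₄ ≤ p →
    k₁ + k₄ ≡ k₂ + k₃ →
    (∀ i j → (0 < X′ p k₁ k₂ k₃ k₄ A i j) ⇔ (A i j ≡ 1)) →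
    .{{_ : NonZero (k₁ * k₄ + k₂ * k₃)}} →
    DoublyStochastic (X p k₁ k₂ k₃ k₄ A)
    × (∀ i j → (X p k₁ k₂ k₃ k₄ A i j ≡ 0ℚ) ⇔ (A i j ≡ 0))
    × (∀ (σ τ : Permutation′ (p + p)) → AvoidsZeros A σ → AvoidsZeros A τ →
         diagSum (X p k₁ k₂ k₃ k₄ A) σ ≡ diagSum (X p k₁ k₂ k₃ k₄ A) τ)
theorem5p4 p _ A zeroOne k₁ k₂ k₃ k₄ R₁ R₂ R₃ R₄ _ _ _ _ k₁+k₄≡k₂+k₃ support =
  ( (λ i j → 0≤n/d (x′ i j) D)
  , (λ i → sumℚ-/-≡1 (x′ i) D (rowSum-X′ R₁ R₂ R₃ R₄ i))
  , (λ j → sumℚ-/-≡1 (λ i → x′ i j) D (colSum-X′ R₁ R₂ R₃ R₄ j)) )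
  , zeros , diagonals
  where
  open Blocks p k₁ k₂ k₃ k₄ A
  D = k₁ * k₄ + k₂ * k₃

  zeros : ∀ i j → (X p k₁ k₂ k₃ k₄ A i j ≡ 0ℚ) ⇔ (A i j ≡ 0)
  zeros i j = mk⇔ (to ∘ n/d≡0⇒n≡0 (x′ i j) D)
                  (λ Aij≡0 → trans (cong (λ n → + n / D) (from Aij≡0)) (ℚ.0/n≡0 D))
    where open Equivalence (X′≡0⇔A≡0 zeroOne support i j)

  diagonals : ∀ σ τ → AvoidsZeros A σ → AvoidsZeros A τ →
              diagSum (X p k₁ k₂ k₃ k₄ A) σ ≡ diagSum (X p k₁ k₂ k₃ k₄ A) τ
  diagonals σ τ σ-avoids τ-avoids = begin
    diagSum (X p k₁ k₂ k₃ k₄ A) σ   ≡⟨ sumℚ-/ (λ i → x′ i (σ ⟨$⟩ʳ i)) D ⟩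
    + diagSumℕ x′ σ / D             ≡⟨ cong (λ n → + n / D)
                                         (diagSumℕ-X′-invariant k₁+k₄≡k₂+k₃ σ τ σ-avoids τ-avoids) ⟩
    + diagSumℕ x′ τ / D             ≡⟨ sumℚ-/ (λ i → x′ i (τ ⟨$⟩ʳ i)) D ⟨
    diagSum (X p k₁ k₂ k₃ k₄ A) τ   ∎
    where open ≡-Reasoning
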